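{- Given an OP word $w$ and positions $i,j,h,k$ in it: (1) if $\chi(i,j)$ and $\chi(h,k)$, then $i<h<j$ implies $k\le j$, and $i<k<j$ implies $i\le h$; (2) if $\chi(i,j)$, then $i\lessdot i+1$ and $j-1\gtrdot j$; (3) for every $j$ there exists at most one position $i$ with $\chi(i,j)$ and ($i\lessdot j$ or $i\doteq j$), and if such an $i$ exists, every $i'$ with $\chi(i',j)$ and $i'\gtrdot j$ satisfies $i'>i$; (4) for every $i$ there exists at most one position $j$ with $\chi(i,j)$ and ($i\gtrdot j$ or $i\doteq j$), and if such a $j$ exists, every $j'$ with $\chi(i,j')$ and $i\lessdot j'$ satisfies $j'<j$.
   Context: Let $AP$ be a finite set of atomic propositions partitioned into normal propositions and structural labels, $\#\notin AP$ an end marker, $\Sigma=2^{AP}$. An operator precedence matrix (OPM) $M$ on $\Sigma$ is a partial function $M:(\Sigma\cup\{\#\})^2\to\{\lessdot,\doteq,\gtrdot\}$, defined only on sets containing exactly one structural label, depending only on structural labels. Write $a\,\pi\,b$ for $M(a,b)=\pi$; by convention $\#\lessdot b$ for every $b$ and $a\gtrdot\#$ for $a\in\Sigma$. A simple chain is $c_0c_1\dots c_\ell c_{\ell+1}$, $\ell\ge1$, $c_0,c_{\ell+1}\in\Sigma\cup\{\#\}$, $c_1..c_\ell\in\Sigma$, $c_0\lessdot c_1\doteq\dots\doteq c_\ell\gtrdot c_{\ell+1}$; a composed chain is $c_0s_0c_1\dots c_\ell s_\ell c_{\ell+1}$ with $c_0c_1\dots c_{\ell+1}$ simple and each $s_k\in\Sigma^*$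 empty or such that $c_ks_kc_{k+1}$ is a chain; $(c_0,c_{\ell+1})$ is the context. $x\in\Sigma^*$ is compatible with $M$ if $M(c,d)$ is defined for consecutive letters and $M(a,b)$ is defined for the context $(a,b)$ of every chain substring of $\#x\#$. An OP word is $w=\langle U,M,P\rangle$ with $U=\{0,\dots,n+1\}$, $P(0)=P(n+1)=\#$, $P(1)\cdots P(n)$ compatible with $M$. For positions, $i\,\pi\,j$ means $P(i)\,\pi\,P(j)$. The chain relation: $\chi(i,j)$ holds iff $i<j-1$ and $P(i)P(i+1)\cdots P(j)$ is a chain. -}

module Defs where

open import Data.Nat using (ℕ; zero; suc; _<_; _≤_; _∸_)
open import Data.List using (List; []; _∷_; _++_; map; take; drop; length)
open import Data.Maybe using (Maybe; just; nothing)
open import Data.Product using (Σ; ∃; ∃₂; _×_; _,_)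
open import Data.Sum using (_⊎_)
open import Data.Fin.Subset using (Subset; _∩_; ∣_∣)
open import Data.List.Relation.Unary.Linked using (Linked)
open import Relation.Binary.PropositionalEquality using (_≡_)

data Prec : Set where
  ⋖ ≐ ⋗ : Prec

-- AP = Fin m, partitioned by the subset S of structural labels
-- (normal propositions = complement of S).  Σ = 2^AP = Subset m.

-- An operator precedence matrix on Σ (the part of M on Σ × Σ).
record OPM {m : ℕ} (S : Subset m) : Set where
  field
    rel : Subset m → Subset m → Maybe Prec
    defined-only-one-struct : ∀ a b π → rel a b ≡ just π →
                              ∣ a ∩ S ∣ ≡ 1 × ∣ b ∩ S ∣ ≡ 1
    depends-only-struct : ∀ a a′ b b′ → a ∩ S ≡ a′ ∩ S → b ∩ S ≡ b′ ∩ S →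
                          rel a b ≡ rel a′ b′

module _ {m : ℕ} {S : Subset m} (M : OPM S) where
  open OPM M

  data Sym : Set where
    hash : Sym
    ltr  : Subset m → Sym

  M′ : Sym → Sym → Maybe Prec
  M′ hash     _        = just ⋖
  M′ (ltr a) hash      = just ⋗
  M′ (ltr a) (ltr b)   = rel a b

  _⟪_⟫_ : Sym → Prec → Sym → Set
  a ⟪ π ⟫ b = M′ a b ≡ just π

  Defined : Sym → Sym → Set
  Defined a b = ∃ λ π → M′ a b ≡ just π

  -- Chains (simple or composed), mutually with admissible gaps s_k
  -- and the tail  s_k c_{k+1} s_{k+1} … s_ℓ c_{ℓ+1}  following a letter c_k ∈ Σ.
  data Chain : List Sym → Set
  data Gap (a b : Sym) : List (Subset m) → Set
  data Tail : Subset m → List Sym → Set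

  data Gap a b where
    empty  : Gap a b []
    nested : ∀ {s} → Chain (a ∷ map ltr s ++ b ∷ []) → Gap a b s

  data Tail where
    end  : ∀ {c s e} → Gap (ltr c) e s → ltr c ⟪ ⋗ ⟫ e →
           Tail c (map ltr s ++ e ∷ [])
    step : ∀ {c s d w} → Gap (ltr c) (ltr d) s → ltr c ⟪ ≐ ⟫ ltr d → Tail d w →
           Tail c (map ltr s ++ ltr d ∷ w)

  data Chain where
    chain : ∀ {c₀ s c₁ w} → Gap c₀ (ltr c₁) s → c₀ ⟪ ⋖ ⟫ ltr c₁ → Tail c₁ w →
            Chain (c₀ ∷ map ltr s ++ ltr c₁ ∷ w)

  framed : List (Subset m) → List Sym
  framed x = hash ∷ map ltr x ++ hash ∷ []

  Compatible : List (Subset m) → Set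
  Compatible x =
    Linked Defined (framed x) ×
    (∀ pre a mid b suf → framed x ≡ pre ++ (a ∷ mid ++ b ∷ []) ++ suf →
       Chain (a ∷ mid ++ b ∷ []) → Defined a b)

-- An OP word ⟨U, M, P⟩: U = {0,…,n+1} with n = length word,
-- P(0) = P(n+1) = #, P(1)⋯P(n) = word.
record OPWord {m : ℕ} {S : Subset m} (M : OPM S) : Set where
  field
    word       : List (Subset m)
    compatible : Compatible M word

module _ {m : ℕ} {S : Subset m} {M : OPM S} (w : OPWord M) where
  open OPWord w

  n : ℕ
  n = length word

  at : List (Sym M) → ℕ → Maybe (Sym M)
  at []       _       = nothing
  at (c ∷ cs) zero    = just c
  at (c ∷ cs) (suc p) = at cs p

  P : ℕ → Maybe (Sym M)
  P = at (framed M word)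

  prec : ℕ → Prec → ℕ → Set
  prec i π j = ∃₂ λ a b → P i ≡ just a × P j ≡ just b × _⟪_⟫_ M a π b

  χ : ℕ → ℕ → Set
  χ i j = suc i < j × j ≤ suc n × Chain M (take (suc j ∸ i) (drop i (framed M word)))

module Submission where

-- The chain relation χ(i,j) is transported to a purely positional notion:
-- for an arbitrary labelling f of positions, PChain a b records that the
-- letters at positions a … b form a chain, remembering only the positions of
-- the top-level letters and of the nested sub-chains filling the gaps.
-- All of the theorem follows from three mutually dependent facts about
-- positional chains, proved together by induction on the total length of
-- the intervals involved:
--   * right bound : if y reaches z through a gap and y ⋗ z or y ≐ z, then
--                   every chain starting at y ends at or before z;
--   * left bound  : dually, if y ⋖ z or y ≐ z, every chain ending at z
--                   starts at or after y;
--   * no crossing : chains (a,b) and (c,d) with a < c < b < d never coexist.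
-- Each step locates a position strictly inside a chain: it lies strictly
-- inside a nested sub-chain, or it is a top-level letter of the chain.

open import Defs
open import Data.Nat using (ℕ; zero; suc; _<_; _≤_; _∸_; _+_; _≤?_; s≤s)
open import Data.Nat.Properties
open import Data.Product using (_×_; _,_; ∃; ∃₂)
open import Data.Sum using (_⊎_; inj₁; inj₂)
open import Data.Fin.Subset using (Subset)
open import Data.Maybe using (Maybe; just)
open import Data.Maybe.Properties using (just-injective)
open import Data.List using (List; []; _∷_; _++_; map; take; drop; length)
open import Data.List.Properties using (length-++; length-map)
open import Data.Empty using (⊥; ⊥-elim)
open import Relation.Nullary using (¬_; yes; no)
open import Relation.Binary.PropositionalEquality
  using (_≡_; refl; sym; trans; cong; subst; module ≡-Reasoning)
open import Relation.Binary.Definitions using (tri<; tri≈; tri>)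

shorter-from-left : ∀ {a y z b} → a < y → y ≤ z → z ≤ b → z ∸ y < b ∸ a
shorter-from-left {a} a<y y≤z z≤b = <-≤-trans (∸-monoʳ-< a<y y≤z) (∸-monoˡ-≤ a z≤b)

shorter-from-right : ∀ {a y z b} → a ≤ y → y ≤ z → z < b → z ∸ y < b ∸ a
shorter-from-right {b = b} a≤y y≤z z<b = <-≤-trans (∸-monoˡ-< z<b y≤z) (∸-monoʳ-≤ b a≤y)

-- The induction measure is a sum of two interval lengths below suc N; these
-- are the ways a recursive call stays below N.
module _ {N a b : ℕ} (μ : a + b < suc N) where

  shrink-left : ∀ {a′} → a′ < a → a′ + b < N
  shrink-left a′<a = <-≤-trans (+-monoˡ-< b a′<a) (≤-pred μ)

  shrink-right : ∀ {b′} → b′ < b → a + b′ < N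
  shrink-right b′<b = <-≤-trans (+-monoʳ-< a b′<b) (≤-pred μ)

  shrink-swap : ∀ {b′} → b′ < b → b′ + a < N
  shrink-swap {b′} b′<b = subst (_< N) (+-comm a b′) (shrink-right b′<b)

module PositionalChains {m : ℕ} {S : Subset m} (M : OPM S) (f : ℕ → Maybe (Sym M)) where

  Rel : ℕ → Prec → ℕ → Set
  Rel p π q = ∃₂ λ a b → f p ≡ just a × f q ≡ just b × _⟪_⟫_ M a π b

  Rel-functional : ∀ {p q π π′} → Rel p π q → Rel p π′ q → π ≡ π′
  Rel-functional (a , b , fa , fb , r) (a′ , b′ , fa′ , fb′ , r′)
    with just-injective (trans (sym fa) fa′) | just-injective (trans (sym fb) fb′)
  ... | refl | refl = just-injective (trans (sym r) r′)

  ⋗-or-≐-excludes-⋖ : ∀ {y z} → Rel y ⋗ z ⊎ Rel y ≐ z → ¬ Rel y ⋖ z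
  ⋗-or-≐-excludes-⋖ (inj₁ r) r′ with Rel-functional r r′
  ... | ()
  ⋗-or-≐-excludes-⋖ (inj₂ r) r′ with Rel-functional r r′
  ... | ()

  ⋖-or-≐-excludes-⋗ : ∀ {y z} → Rel y ⋖ z ⊎ Rel y ≐ z → ¬ Rel y ⋗ z
  ⋖-or-≐-excludes-⋗ (inj₁ r) r′ with Rel-functional r r′
  ... | ()
  ⋖-or-≐-excludes-⋗ (inj₂ r) r′ with Rel-functional r r′
  ... | ()

  -- Positional chains, mirroring Gap, Chain and Tail of Defs:
  -- PGap a b: the positions strictly between a and b are empty or form a
  -- chain with a and b; PChain a b: positions a … b form a chain;
  -- PTail p b: the rest of a chain from its top-level position p to its end b.
  data PGap : ℕ → ℕ → Set
  data PChain : ℕ → ℕ → Set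
  data PTail : ℕ → ℕ → Set

  data PGap where
    adjacent : ∀ {a} → PGap a (suc a)
    spans    : ∀ {a b} → PChain a b → PGap a b

  data PChain where
    pchain : ∀ {a q b} → PGap a q → Rel a ⋖ q → PTail q b → PChain a b

  data PTail where
    close    : ∀ {p b} → PGap p b → Rel p ⋗ b → PTail p b
    continue : ∀ {p q b} → PGap p q → Rel p ≐ q → PTail q b → PTail p b

  gap-< : ∀ {a b} → PGap a b → a < b
  chain-< : ∀ {a b} → PChain a b → suc a < b
  tail-< : ∀ {a b} → PTail a b → a < b
  gap-< adjacent = ≤-refl
  gap-< (spans c) = <-trans (n<1+n _) (chain-< c)
  chain-< (pchain g _ t) = ≤-<-trans (gap-< g) (tail-< t)
  tail-< (close g _) = gap-< g
  tail-< (continue g _ t) = <-trans (gap-< g) (tail-< t)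

  gap-is-chain : ∀ {y x z} → PGap y z → y < x → x < z → PChain y z
  gap-is-chain adjacent y<x x<y+1 = ⊥-elim (<⇒≱ y<x (≤-pred x<y+1))
  gap-is-chain (spans c) _ _ = c

  chain-opens : ∀ {a b} → PChain a b → Rel a ⋖ (suc a)
  chain-opens (pchain adjacent r _) = r
  chain-opens (pchain (spans c) _ _) = chain-opens c

  chain-closes : ∀ {a b} → PChain a b → Rel (b ∸ 1) ⋗ b
  tail-closes : ∀ {p b} → PTail p b → Rel (b ∸ 1) ⋗ b
  chain-closes (pchain _ _ t) = tail-closes t
  tail-closes (close adjacent r) = r
  tail-closes (close (spans c) _) = chain-closes c
  tail-closes (continue _ _ t) = tail-closes t

  data Exit (x b : ℕ) : Set where
    exit-closes    : PGap x b → Rel x ⋗ b → Exit x b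
    exit-continues : ∀ {w} → PGap x w → Rel x ≐ w → w < b → Exit x b

  exit-bound : ∀ {x b} → Exit x b → ∃ λ w → PGap x w × (Rel x ⋗ w ⊎ Rel x ≐ w) × w ≤ b
  exit-bound (exit-closes g r) = _ , g , inj₁ r , ≤-refl
  exit-bound (exit-continues g r w<b) = _ , g , inj₂ r , <⇒≤ w<b

  tail-exit : ∀ {p b} → PTail p b → Exit p b
  tail-exit (close g r) = exit-closes g r
  tail-exit (continue g r t) = exit-continues g r (tail-< t)

  data Entry (a x : ℕ) : Set where
    entry-opens   : Rel a ⋖ x → Entry a x
    entry-follows : ∀ {y} → PGap y x → a < y → Rel y ≐ x → Entry a x

  data Location (a b x : ℕ) : Set where
    inside   : ∀ {y z} → PChain y z → y < x → x < z → a ≤ y → z ≤ b →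
               z ∸ y < b ∸ a → Location a b x
    toplevel : Entry a x → Exit x b → Location a b x

  data TailLocation (p b x : ℕ) : Set where
    tail-inside   : ∀ {y z} → PChain y z → y < x → x < z → p ≤ y → z ≤ b →
                    TailLocation p b x
    tail-toplevel : ∀ {y} → PGap y x → p ≤ y → Rel y ≐ x → Exit x b →
                    TailLocation p b x

  locate-in-tail : ∀ {p b x} → PTail p b → p < x → x < b → TailLocation p b x
  locate-in-tail (close g _) p<x x<b = tail-inside (gap-is-chain g p<x x<b) p<x x<b ≤-refl ≤-refl
  locate-in-tail {x = x} (continue {q = q} g r t) p<x x<b with <-cmp x q
  ... | tri< x<q _ _ = tail-inside (gap-is-chain g p<x x<q) p<x x<q ≤-refl (<⇒≤ (tail-< t))
  ... | tri≈ _ refl _ = tail-toplevel g ≤-refl r (tail-exit t)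
  ... | tri> _ _ q<x with locate-in-tail t q<x x<b
  ...   | tail-inside c y<x x<z q≤y z≤b = tail-inside c y<x x<z (≤-trans (<⇒≤ (gap-< g)) q≤y) z≤b
  ...   | tail-toplevel g′ q≤y r′ e = tail-toplevel g′ (≤-trans (<⇒≤ (gap-< g)) q≤y) r′ e

  locate : ∀ {a b x} → PChain a b → a < x → x < b → Location a b x
  locate {a} {x = x} (pchain {q = q} g r t) a<x x<b with <-cmp x q
  ... | tri< x<q _ _ = inside (gap-is-chain g a<x x<q) a<x x<q ≤-refl (<⇒≤ (tail-< t))
                         (shorter-from-right ≤-refl (<⇒≤ (<-trans a<x x<q)) (tail-< t))
  ... | tri≈ _ refl _ = toplevel (entry-opens r) (tail-exit t)
  ... | tri> _ _ q<x with locate-in-tail t q<x x<b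
  ...   | tail-inside {y} c y<x x<z q≤y z≤b = inside c y<x x<z (<⇒≤ a<y) z≤b
                                               (shorter-from-left a<y (<⇒≤ (<-trans y<x x<z)) z≤b)
    where
    a<y : a < y
    a<y = <-≤-trans (gap-< g) q≤y
  ...   | tail-toplevel g′ q≤y r′ e = toplevel (entry-follows g′ (<-≤-trans (gap-< g) q≤y) r′) e

  RightBounded : ℕ → Set
  RightBounded N = ∀ {y z d} → PGap y z → Rel y ⋗ z ⊎ Rel y ≐ z → PChain y d →
                   (z ∸ y) + (d ∸ y) < N → d ≤ z

  LeftBounded : ℕ → Set
  LeftBounded N = ∀ {x y z} → PGap y z → Rel y ⋖ z ⊎ Rel y ≐ z → PChain x z →
                  (z ∸ y) + (z ∸ x) < N → y ≤ x

  NonCrossing : ℕ → Set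
  NonCrossing N = ∀ {a b c d} → PChain a b → PChain c d → a < c → c < b → b < d →
                  (b ∸ a) + (d ∸ c) < N → ⊥

  record Bounded (N : ℕ) : Set where
    field
      right-bounded : RightBounded N
      left-bounded  : LeftBounded N
      non-crossing  : NonCrossing N

  module _ {N : ℕ} (ih : Bounded N) where
    open Bounded ih

    -- A chain (y,d) overshooting z contains z; z is not inside a sub-chain
    -- (it would cross the gap (y,z) or overshoot z itself), and as a
    -- top-level letter it is neither opened by y nor preceded inside (y,z).
    right-bounded-step : RightBounded (suc N)
    right-bounded-step {y} {z} {d} g rel C μ with d ≤? z
    ... | yes d≤z = d≤z
    ... | no d≰z with ≰⇒> d≰z
    ...   | z<d with locate C (gap-< g) z<d
    ...     | inside c y′<z z<z′ y≤y′ _ shorter with m≤n⇒m<n∨m≡n y≤y′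
    ...       | inj₁ y<y′ = ⊥-elim (non-crossing (gap-is-chain g y<y′ y′<z) c y<y′ y′<z z<z′
                                                  (shrink-right μ shorter))
    ...       | inj₂ refl = ⊥-elim (<⇒≱ z<z′ (right-bounded g rel c (shrink-right μ shorter)))
    right-bounded-step g rel C μ | no _ | z<d | toplevel (entry-opens r) _ =
      ⊥-elim (⋗-or-≐-excludes-⋖ rel r)
    right-bounded-step g rel C μ | no _ | z<d | toplevel (entry-follows g′ y<y′ r′) _ =
      ⊥-elim (<⇒≱ y<y′ (left-bounded g′ (inj₂ r′) (gap-is-chain g y<y′ (gap-< g′))
        (shrink-swap μ (shorter-from-left y<y′ (<⇒≤ (gap-< g′)) (<⇒≤ z<d)))))

    left-bounded-step : LeftBounded (suc N)
    left-bounded-step {x} {y} {z} g rel C μ with y ≤? x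
    ... | yes y≤x = y≤x
    ... | no y≰x with ≰⇒> y≰x
    ...   | x<y with locate C x<y (gap-< g)
    ...     | inside c y′<y y<z′ _ z′≤z shorter with m≤n⇒m<n∨m≡n z′≤z
    ...       | inj₁ z′<z = ⊥-elim (non-crossing c (gap-is-chain g y<z′ z′<z) y′<y y<z′ z′<z
                                                  (shrink-swap μ shorter))
    ...       | inj₂ refl = ⊥-elim (<⇒≱ y′<y (left-bounded g rel c (shrink-right μ shorter)))
    left-bounded-step g rel C μ | no _ | x<y | toplevel _ (exit-closes _ r) =
      ⊥-elim (⋖-or-≐-excludes-⋗ rel r)
    left-bounded-step g rel C μ | no _ | x<y | toplevel _ (exit-continues g′ r w<z) =
      ⊥-elim (<⇒≱ w<z (right-bounded g′ (inj₂ r) (gap-is-chain g (gap-< g′) w<z)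
        (shrink-swap μ (shorter-from-left x<y (<⇒≤ (gap-< g′)) (<⇒≤ w<z)))))

    -- If c lies in a sub-chain of (a,b), that sub-chain crosses (c,d);
    -- if c is top-level, the chain (c,d) overshoots the next top-level letter.
    non-crossing-step : NonCrossing (suc N)
    non-crossing-step C₁ C₂ a<c c<b b<d μ with locate C₁ a<c c<b
    ... | inside c′ y′<c c<z′ _ z′≤b shorter =
      non-crossing c′ C₂ y′<c c<z′ (≤-<-trans z′≤b b<d) (shrink-left μ shorter)
    ... | toplevel _ e with exit-bound e
    ...   | _ , g , rel , w≤b = <⇒≱ (≤-<-trans w≤b b<d)
            (right-bounded g rel C₂ (shrink-left μ (shorter-from-left a<c (<⇒≤ (gap-< g)) w≤b)))

  bounded : ∀ N → Bounded N
  bounded zero = record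
    { right-bounded = λ _ _ _ ()
    ; left-bounded  = λ _ _ _ ()
    ; non-crossing  = λ _ _ _ _ _ ()
    }
  bounded (suc N) = record
    { right-bounded = right-bounded-step (bounded N)
    ; left-bounded  = left-bounded-step (bounded N)
    ; non-crossing  = non-crossing-step (bounded N)
    }

  right-bound : ∀ {y z d} → PGap y z → Rel y ⋗ z ⊎ Rel y ≐ z → PChain y d → d ≤ z
  right-bound g r c = Bounded.right-bounded (bounded _) g r c ≤-refl

  left-bound : ∀ {x y z} → PGap y z → Rel y ⋖ z ⊎ Rel y ≐ z → PChain x z → y ≤ x
  left-bound g r c = Bounded.left-bounded (bounded _) g r c ≤-refl

  no-crossing : ∀ {a b c d} → PChain a b → PChain c d → a < c → c < b → b < d → ⊥
  no-crossing C₁ C₂ a<c c<b b<d = Bounded.non-crossing (bounded _) C₁ C₂ a<c c<b b<d ≤-refl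

  chains-nest : ∀ {i j h k} → PChain i j → PChain h k →
                (i < h → h < j → k ≤ j) × (i < k → k < j → i ≤ h)
  chains-nest cij chk =
    (λ i<h h<j → ≮⇒≥ (λ j<k → no-crossing cij chk i<h h<j j<k)) ,
    (λ i<k k<j → ≮⇒≥ (λ h<i → no-crossing chk cij h<i i<k k<j))

  left-context-unique : ∀ {y y′ z} → PChain y z → Rel y ⋖ z ⊎ Rel y ≐ z →
                        PChain y′ z → Rel y′ ⋖ z ⊎ Rel y′ ≐ z → y ≡ y′
  left-context-unique c r c′ r′ = ≤-antisym (left-bound (spans c) r c′) (left-bound (spans c′) r′ c)

  left-context-outer : ∀ {y y′ z} → PChain y z → Rel y ⋖ z ⊎ Rel y ≐ z →
                       PChain y′ z → Rel y′ ⋗ z → y < y′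
  left-context-outer c r c′ r′ =
    ≤∧≢⇒< (left-bound (spans c) r c′) (λ { refl → ⋖-or-≐-excludes-⋗ r r′ })

  right-context-unique : ∀ {y z z′} → PChain y z → Rel y ⋗ z ⊎ Rel y ≐ z →
                         PChain y z′ → Rel y ⋗ z′ ⊎ Rel y ≐ z′ → z ≡ z′
  right-context-unique c r c′ r′ = ≤-antisym (right-bound (spans c′) r′ c) (right-bound (spans c) r c′)

  right-context-outer : ∀ {y z z′} → PChain y z → Rel y ⋗ z ⊎ Rel y ≐ z →
                        PChain y z′ → Rel y ⋖ z′ → z′ < z
  right-context-outer c r c′ r′ =
    ≤∧≢⇒< (right-bound (spans c) r c′) (λ { refl → ⋗-or-≐-excludes-⋖ r r′ })

  data Reads : List (Sym M) → ℕ → ℕ → Set where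
    []  : ∀ {o} → Reads [] o o
    _∷_ : ∀ {x xs o e} → f o ≡ just x → Reads xs (suc o) e → Reads (x ∷ xs) o e

  split : ∀ L₁ {L₂ o e} → Reads (L₁ ++ L₂) o e → ∃ λ k → Reads L₁ o k × Reads L₂ k e
  split []       r        = _ , [] , r
  split (x ∷ L₁) (fx ∷ r) with split L₁ r
  ... | k , r₁ , r₂ = k , fx ∷ r₁ , r₂

  append : ∀ {L₁ L₂ o k e} → Reads L₁ o k → Reads L₂ k e → Reads (L₁ ++ L₂) o e
  append []         r₂ = r₂
  append (fx ∷ r₁) r₂ = fx ∷ append r₁ r₂

  reads-drop : ∀ k {L o e} → Reads L o e → o + k ≤ e → Reads (drop k L) (o + k) e
  reads-drop zero    {o = o} r        _  rewrite +-identityʳ o = r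
  reads-drop (suc k) {o = o} []       le = ⊥-elim (m+1+n≰m o le)
  reads-drop (suc k) {o = o} (_ ∷ r) le rewrite +-suc o k = reads-drop k r le

  reads-take : ∀ k {L o e} → Reads L o e → o + k ≤ e → Reads (take k L) o (o + k)
  reads-take zero    {o = o} _        _  rewrite +-identityʳ o = []
  reads-take (suc k) {o = o} []       le = ⊥-elim (m+1+n≰m o le)
  reads-take (suc k) {o = o} (fx ∷ r) le rewrite +-suc o k = fx ∷ reads-take k r le

  reads-window : ∀ {L e i j} → Reads L 0 e → i ≤ j → j ≤ e → Reads (take (j ∸ i) (drop i L)) i j
  reads-window {i = i} {j} r i≤j j≤e =
    subst (Reads _ i) i+[j∸i]≡j
      (reads-take (j ∸ i) (reads-drop i r (≤-trans i≤j j≤e)) (subst (_≤ _) (sym i+[j∸i]≡j) j≤e))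
    where
    i+[j∸i]≡j : i + (j ∸ i) ≡ j
    i+[j∸i]≡j = m+[n∸m]≡n i≤j

  gap-reading : ∀ {a b s o k} → Gap M a b s → f o ≡ just a → Reads (map ltr s) (suc o) k →
                f k ≡ just b → PGap o k
  tail-reading : ∀ {c w p e} → Tail M c w → f p ≡ just (ltr c) → Reads w (suc p) (suc e) → PTail p e
  chain-reading : ∀ {L o e} → Chain M L → Reads L o (suc e) → PChain o e

  gap-reading empty _ [] _ = adjacent
  gap-reading (nested ch) fa r fb = spans (chain-reading ch (fa ∷ append r (fb ∷ [])))

  tail-reading {c} (end {s = s} {e = e′} g r) fc rd with split (map ltr s) rd
  ... | _ , rs , (fe ∷ []) = close (gap-reading g fc rs fe) (ltr c , e′ , fc , fe , r)
  tail-reading {c} (step {s = s} {d = d} g r t) fc rd with split (map ltr s) rd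
  ... | _ , rs , (fd ∷ rt) = continue (gap-reading g fc rs fd) (ltr c , ltr d , fc , fd , r)
                                      (tail-reading t fd rt)

  chain-reading (chain {c₀} {s} {c₁} g r t) (f₀ ∷ rd) with split (map ltr s) rd
  ... | _ , rs , (f₁ ∷ rt) = pchain (gap-reading g f₀ rs f₁) (c₀ , ltr c₁ , f₀ , f₁ , r)
                                    (tail-reading t f₁ rt)

module WordChains {m : ℕ} {S : Subset m} {M : OPM S} (w : OPWord M) where
  open OPWord w
  open PositionalChains M (P w)

  module Lookup (source : List (Sym M)) = PositionalChains M (at w source)

  reads-shift : ∀ {x L K o e} → Lookup.Reads L K o e → Lookup.Reads (x ∷ L) K (suc o) (suc e)
  reads-shift {x} {L} Lookup.[] = Lookup.[] {source = x ∷ L}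
  reads-shift {x} {L} (fx Lookup.∷ r) = Lookup._∷_ {source = x ∷ L} fx (reads-shift r)

  reads-own : ∀ L → Lookup.Reads L L 0 (length L)
  reads-own [] = Lookup.[] {source = []}
  reads-own (x ∷ L) = Lookup._∷_ {source = x ∷ L} refl (reads-shift (reads-own L))

  framed-length : length (framed M word) ≡ suc (suc (n w))
  framed-length = cong suc (begin
    length (map ltr word ++ hash ∷ [])  ≡⟨ length-++ (map ltr word) ⟩
    length (map ltr word) + 1           ≡⟨ cong (_+ 1) (length-map ltr word) ⟩
    length word + 1                     ≡⟨ +-comm (length word) 1 ⟩
    suc (length word)                   ∎)
    where open ≡-Reasoning

  χ-chain : ∀ {i j} → χ w i j → PChain i j
  χ-chain {i} {j} (i+1<j , j≤n+1 , ch) =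
    chain-reading ch (reads-window (subst (Reads _ 0) framed-length (reads-own (framed M word)))
                                   (≤-trans (<⇒≤ (<-trans (n<1+n i) i+1<j)) (n≤1+n j))
                                   (s≤s j≤n+1))

lemma3 : ∀ {m} (S : Subset m) (M : OPM S) (w : OPWord M) →
    (∀ i j h k → χ w i j → χ w h k →
       (i < h → h < j → k ≤ j) × (i < k → k < j → i ≤ h))
    × (∀ i j → χ w i j → prec w i ⋖ (suc i) × prec w (j ∸ 1) ⋗ j)
    × (∀ j →
       (∀ i i₁ → χ w i j → (prec w i ⋖ j ⊎ prec w i ≐ j) →
          χ w i₁ j → (prec w i₁ ⋖ j ⊎ prec w i₁ ≐ j) → i ≡ i₁)
       × (∀ i i′ → χ w i j → (prec w i ⋖ j ⊎ prec w i ≐ j) →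
          χ w i′ j → prec w i′ ⋗ j → i < i′))
    × (∀ i →
       (∀ j j₁ → χ w i j → (prec w i ⋗ j ⊎ prec w i ≐ j) →
          χ w i j₁ → (prec w i ⋗ j₁ ⊎ prec w i ≐ j₁) → j ≡ j₁)
       × (∀ j j′ → χ w i j → (prec w i ⋗ j ⊎ prec w i ≐ j) →
          χ w i j′ → prec w i ⋖ j′ → j′ < j))
lemma3 S M w =
  (λ _ _ _ _ c d → chains-nest (χ-chain c) (χ-chain d)) ,
  (λ _ _ c → chain-opens (χ-chain c) , chain-closes (χ-chain c)) ,
  (λ _ → (λ _ _ c r c′ r′ → left-context-unique (χ-chain c) r (χ-chain c′) r′) ,
         (λ _ _ c r c′ r′ → left-context-outer (χ-chain c) r (χ-chain c′) r′)) ,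
  (λ _ → (λ _ _ c r c′ r′ → right-context-unique (χ-chain c) r (χ-chain c′) r′) ,
         (λ _ _ c r c′ r′ → right-context-outer (χ-chain c) r (χ-chain c′) r′))
  where
  open WordChains w
  open PositionalChains M (P w)
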